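{- (Soundness.) For every set of sequents $S$ and every sequent $s$: if $S\vdash_{\mathtt{CHC}}s$, then $\tau(S)\vDash_{\mathcal{CHA}}\tau(s)$.
   Context: Formulas are built from variables with binary $\wedge,\vee,\rightarrow$ and constants $0,1$; $\neg\alpha:=\alpha\rightarrow 0$. A sequent $\Gamma\blacktriangleright\Pi$ is a pair of a finite set $\Gamma$ of formulas and a set $\Pi$ that is empty or a singleton; commas denote union. $\mathtt{CHC}$ has axioms (id) $\alpha\blacktriangleright\alpha$; (0) $0\blacktriangleright$; (1) $\blacktriangleright 1$; rules (w-l) $\Gamma\blacktriangleright\Pi/\alpha,\Gamma\blacktriangleright\Pi$; (w-r) $\Gamma\blacktriangleright/\Gamma\blacktriangleright\alpha$; (cut) $\Gamma\blacktriangleright\alpha$, $\alpha,\Delta\blacktriangleright\Pi/\Gamma,\Delta\blacktriangleright\Pi$; ($\wedge$-l) $\alpha,\Gamma\blacktriangleright\Pi/\alpha\wedge\beta,\Gamma\blacktriangleright\Pi$ and $\beta,\Gamma\blacktriangleright\Pi/\alpha\wedge\beta,\Gamma\blacktriangleright\Pi$; ($\wedge$-r) $\Gamma\blacktriangleright\alpha$, $\Gamma\blacktriangleright\beta/\Gamma\blacktriangleright\alpha\wedge\beta$; ($\vee$-r) $\Gamma\blacktriangleright\alpha/\Gamma\blacktriangleright\alpha\vee\beta$ and $\Gamma\blacktriangleright\beta/\Gamma\blacktriangleright\alpha\vee\beta$; ($\vee$-l) $\alpha,\Gamma\blacktriangleright\Pi$, $\beta,\Gamma\blacktriangleright\Pi/\alpha\vee\beta,\Gamma\blacktriangleright\Pi$;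 ($\rightarrow$-l(a)) $\Gamma\blacktriangleright\alpha$, $\Delta,\beta\blacktriangleright\Pi/\Delta,\Gamma,\alpha\rightarrow\beta\blacktriangleright\Pi$; ($\rightarrow$-l(b)) $\neg\alpha,\Gamma\blacktriangleright\beta$, $\Delta,\alpha,\beta\blacktriangleright/\Gamma,\Delta,\alpha\rightarrow\beta\blacktriangleright$; ($\rightarrow$-r) $\alpha,\Gamma\blacktriangleright\beta$, $\Delta,\neg\alpha,\beta\blacktriangleright/\Gamma,\Delta\blacktriangleright\alpha\rightarrow\beta$. $S\vdash_{\mathtt{CHC}}s$ means $s$ is derivable from the sequents in $S$ (used as extra axioms). For a sequent, $\Gamma^{\wedge}$ is the conjunction of $\Gamma$ (associated to the left), or $1$ if $\Gamma=\emptyset$; $\Pi^{\vee}$ is $\varphi$ if $\Pi=\{\varphi\}$ and $0$ if $\Pi=\emptyset$. $\tau(\Gamma\blacktriangleright\Pi)$ is the inequation $\Gamma^{\wedge}\le\Pi^{\vee}$ (i.e. the equation $\Gamma^{\wedge}\approx\Gamma^{\wedge}\wedge\Pi^{\vee}$), and $\tau(S)=\{\tau(s):s\in S\}$. A connexive Heyting algebra is an algebra $\langle A,\wedge,\vee,\rightarrow,0,1\rangle$ whose $\{\wedge,\vee,0,1\}$-reduct is a bounded distributive lattice (order $\le$) satisfying, with $\neg x:=x\rightarrow0$: (C1) $(x\rightarrow y)\rightarrow((y\rightarrow z)\rightarrow(x\rightarrow z))=1$; (C2) $(x\rightarrow y)\rightarrow\neg(x\rightarrow\neg y)=1$; (C3)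 $x\wedge(x\rightarrow y)=x\wedge y$; (C4) $x\rightarrow y\le(z\wedge x)\rightarrow(z\wedge y)$; (C5) $x\rightarrow y\le(z\vee x)\rightarrow(z\vee y)$. $\vDash_{\mathcal{CHA}}$ is equational consequence over the class of connexive Heyting algebras. -}

module Defs where

open import Level using (Level; _⊔_) renaming (suc to lsuc; zero to lzero)
open import Data.Nat using (ℕ)
open import Data.List using (List; []; _∷_; foldl; _++_)
open import Data.List.Membership.Propositional using (_∈_)
open import Data.Maybe using (Maybe; just; nothing)
open import Data.Product using (_×_; _,_; proj₁; proj₂; Σ)
open import Relation.Binary.PropositionalEquality using (_≡_)
open import Algebra.Lattice.Structures using (IsDistributiveLattice)

infixr 5 _⇒_
infixl 7 _∧_
infixl 6 _∨_

data Formula : Set where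
  var  : ℕ → Formula
  _∧_  : Formula → Formula → Formula
  _∨_  : Formula → Formula → Formula
  _⇒_  : Formula → Formula → Formula
  𝟎 𝟏  : Formula

infix 8 ¬_
¬_ : Formula → Formula
¬ α = α ⇒ 𝟎

-- The finite set Γ is represented by a list; lists with the
-- same elements represent the same set (rule `set-eq` below), and
-- "commas" (union) are list concatenation / cons.
-- The succedent (empty or singleton) is a Maybe Formula.

Ctx : Set
Ctx = List Formula

infix 4 _▸_
record Sequent : Set where
  constructor _▸_
  field
    ante : Ctx
    succ : Maybe Formula

_≈ₛ_ : Ctx → Ctx → Set
Γ ≈ₛ Δ = ∀ φ → (φ ∈ Γ → φ ∈ Δ) × (φ ∈ Δ → φ ∈ Γ)

SeqSet : Set₁
SeqSet = Sequent → Set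

infix 3 _⊢CHC_
data _⊢CHC_ (S : SeqSet) : Sequent → Set where
  ax     : ∀ {s} → S s → S ⊢CHC s
  set-eq : ∀ {Γ Γ' Π} → Γ ≈ₛ Γ' → S ⊢CHC Γ ▸ Π → S ⊢CHC Γ' ▸ Π
  id     : ∀ {α} → S ⊢CHC (α ∷ []) ▸ just α
  ax0    : S ⊢CHC (𝟎 ∷ []) ▸ nothing
  ax1    : S ⊢CHC [] ▸ just 𝟏
  w-l    : ∀ {α Γ Π} → S ⊢CHC Γ ▸ Π → S ⊢CHC (α ∷ Γ) ▸ Π
  w-r    : ∀ {α Γ} → S ⊢CHC Γ ▸ nothing → S ⊢CHC Γ ▸ just α
  cut    : ∀ {α Γ Δ Π} → S ⊢CHC Γ ▸ just α → S ⊢CHC (α ∷ Δ) ▸ Π →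
           S ⊢CHC (Γ ++ Δ) ▸ Π
  ∧-l₁   : ∀ {α β Γ Π} → S ⊢CHC (α ∷ Γ) ▸ Π → S ⊢CHC ((α ∧ β) ∷ Γ) ▸ Π
  ∧-l₂   : ∀ {α β Γ Π} → S ⊢CHC (β ∷ Γ) ▸ Π → S ⊢CHC ((α ∧ β) ∷ Γ) ▸ Π
  ∧-r    : ∀ {α β Γ} → S ⊢CHC Γ ▸ just α → S ⊢CHC Γ ▸ just β →
           S ⊢CHC Γ ▸ just (α ∧ β)
  ∨-r₁   : ∀ {α β Γ} → S ⊢CHC Γ ▸ just α → S ⊢CHC Γ ▸ just (α ∨ β)
  ∨-r₂   : ∀ {α β Γ} → S ⊢CHC Γ ▸ just β → S ⊢CHC Γ ▸ just (α ∨ β)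
  ∨-l    : ∀ {α β Γ Π} → S ⊢CHC (α ∷ Γ) ▸ Π → S ⊢CHC (β ∷ Γ) ▸ Π →
           S ⊢CHC ((α ∨ β) ∷ Γ) ▸ Π
  ⇒-la   : ∀ {α β Γ Δ Π} → S ⊢CHC Γ ▸ just α → S ⊢CHC (Δ ++ (β ∷ [])) ▸ Π →
           S ⊢CHC (Δ ++ Γ ++ ((α ⇒ β) ∷ [])) ▸ Π
  ⇒-lb   : ∀ {α β Γ Δ} → S ⊢CHC ((¬ α) ∷ Γ) ▸ just β →
           S ⊢CHC (Δ ++ (α ∷ β ∷ [])) ▸ nothing →
           S ⊢CHC (Γ ++ Δ ++ ((α ⇒ β) ∷ [])) ▸ nothing
  ⇒-r    : ∀ {α β Γ Δ} → S ⊢CHC (α ∷ Γ) ▸ just β →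
           S ⊢CHC (Δ ++ ((¬ α) ∷ β ∷ [])) ▸ nothing →
           S ⊢CHC (Γ ++ Δ) ▸ just (α ⇒ β)

Equation : Set
Equation = Formula × Formula

conj : Ctx → Formula
conj []      = 𝟏
conj (α ∷ Γ) = foldl _∧_ α Γ

disj : Maybe Formula → Formula
disj (just φ) = φ
disj nothing  = 𝟎

τ : Sequent → Equation
τ (Γ ▸ Π) = conj Γ , conj Γ ∧ disj Π

τS : SeqSet → Equation → Set
τS S e = Σ Sequent (λ s → S s × τ s ≡ e)

record CHA (c : Level) : Set (lsuc c) where
  infixr 5 _→ₐ_
  infixl 7 _⊓_
  infixl 6 _⊔ₐ_
  field
    Carrier : Set c
    _⊓_     : Carrier → Carrier → Carrier
    _⊔ₐ_    : Carrier → Carrier → Carrier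
    _→ₐ_    : Carrier → Carrier → Carrier
    bot top : Carrier

  ¬ₐ_ : Carrier → Carrier
  ¬ₐ x = x →ₐ bot

  _≤ₐ_ : Carrier → Carrier → Set c
  x ≤ₐ y = x ≡ x ⊓ y

  field
    isDistributiveLattice : IsDistributiveLattice _≡_ _⊔ₐ_ _⊓_
    bot-least : ∀ x → bot ≤ₐ x
    top-great : ∀ x → x ≤ₐ top
    C1 : ∀ x y z → (x →ₐ y) →ₐ ((y →ₐ z) →ₐ (x →ₐ z)) ≡ top
    C2 : ∀ x y → (x →ₐ y) →ₐ (¬ₐ (x →ₐ ¬ₐ y)) ≡ top
    C3 : ∀ x y → x ⊓ (x →ₐ y) ≡ x ⊓ y
    C4 : ∀ x y z → (x →ₐ y) ≤ₐ ((z ⊓ x) →ₐ (z ⊓ y))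
    C5 : ∀ x y z → (x →ₐ y) ≤ₐ ((z ⊔ₐ x) →ₐ (z ⊔ₐ y))

  ⟦_⟧ : Formula → (ℕ → Carrier) → Carrier
  ⟦ var n ⟧ v = v n
  ⟦ α ∧ β ⟧ v = ⟦ α ⟧ v ⊓ ⟦ β ⟧ v
  ⟦ α ∨ β ⟧ v = ⟦ α ⟧ v ⊔ₐ ⟦ β ⟧ v
  ⟦ α ⇒ β ⟧ v = ⟦ α ⟧ v →ₐ ⟦ β ⟧ v
  ⟦ 𝟎 ⟧ v = bot
  ⟦ 𝟏 ⟧ v = top

  Sat : (ℕ → Carrier) → Equation → Set c
  Sat v e = ⟦ proj₁ e ⟧ v ≡ ⟦ proj₂ e ⟧ v

_⊨CHA[_]_ : (Equation → Set) → (c : Level) → Equation → Set (lsuc c)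
E ⊨CHA[ c ] e = (A : CHA c) (v : ℕ → CHA.Carrier A) →
  (∀ e' → E e' → CHA.Sat A v e') → CHA.Sat A v e

-- Soundness is proved in a context-independent form: every x below the value of
-- each formula of Γ lies below the value of Π.  Since ⟦Γ^∧⟧ is the greatest such
-- x this is τ(Γ ▸ Π), and the form is stable under the reorderings, weakenings
-- and context splits of the calculus.  Only the connexive rules for ⇒ need more
-- than lattice reasoning.  In a connexive Heyting algebra negation is still the
-- pseudo-complement (z ≤ ¬x iff z ⊓ x ≤ 0), C1 makes implication transitive, and
-- Aristotle's thesis x ⇒ ¬x = 0, an instance of C2, yields 0 ⇒ x ≤ ¬x.  With C4
-- this shows that x ⇒ y, ¬x and y are jointly inconsistent (rule ⇒-l(b)), and that
-- z ≤ x ⇒ y follows from z ⊓ x ≤ y and z ⊓ ¬x ⊓ y ≤ 0 by passing through x ⊓ y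
-- (rule ⇒-r).
module Submission where

open import Defs
open import Level using (Level)
open import Data.Nat using (ℕ)
open import Data.List using ([]; _∷_; foldl)
open import Data.List.Relation.Unary.All using (All; []; _∷_; head; tail)
import Data.List.Relation.Unary.All as All
open import Data.List.Relation.Unary.All.Properties using (++⁺; ++⁻ˡ; ++⁻ʳ; anti-mono)
open import Data.Product using (_×_; _,_; proj₁)
open import Relation.Binary.PropositionalEquality as ≡ using (_≡_; cong; cong₂; module ≡-Reasoning)
open import Algebra.Lattice.Structures using (IsDistributiveLattice)
import Algebra.Lattice.Properties.Lattice as LatticeProperties
import Relation.Binary.Lattice as OrderLattice
import Relation.Binary.Lattice.Properties.JoinSemilattice as JoinSemilatticeProperties
import Relation.Binary.Reasoning.PartialOrder as ≤-Reasoning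

module CHAProperties {c : Level} (A : CHA c) where

  open CHA A
  open IsDistributiveLattice isDistributiveLattice
    using (isLattice; ∧-comm; ∨-comm; ∧-distribˡ-∨)

  -- The order of this lattice, x ≡ x ⊓ y, is definitionally CHA's _≤ₐ_.
  orderLattice : OrderLattice.Lattice c c c
  orderLattice = LatticeProperties.∨-∧-orderTheoreticLattice (record { isLattice = isLattice })

  open OrderLattice.Lattice orderLattice public
    using (_≤_; poset; x∧y≤x; x∧y≤y; ∧-greatest; x≤x∨y; y≤x∨y; ∨-least)
    renaming (refl to ≤-refl; trans to ≤-trans; antisym to ≤-antisym; reflexive to ≤-reflexive)
  open JoinSemilatticeProperties (OrderLattice.Lattice.joinSemilattice orderLattice) public
    using (x≤y⇒x∨y≈y)

  private variable
    x y z : Carrier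

  ⊓-identityˡ : top ⊓ x ≡ x
  ⊓-identityˡ {x} = ≡.trans (∧-comm top x) (≡.sym (top-great x))

  ⊓-identityʳ : x ⊓ top ≡ x
  ⊓-identityʳ {x} = ≡.sym (top-great x)

  ⊓-zeroʳ : x ⊓ bot ≡ bot
  ⊓-zeroʳ {x} = ≤-antisym (x∧y≤y x bot) (bot-least _)

  ⇒-eval : x ⊓ (x →ₐ y) ≤ y
  ⇒-eval {x} {y} = begin
    x ⊓ (x →ₐ y) ≡⟨ C3 x y ⟩
    x ⊓ y        ≤⟨ x∧y≤y x y ⟩
    y            ∎
    where open ≤-Reasoning poset

  ⇒-elim : z ≤ x → z ≤ x →ₐ y → z ≤ y
  ⇒-elim p q = ≤-trans (∧-greatest p q) ⇒-eval

  ⇒≡top⇒≤ : x →ₐ y ≡ top → x ≤ y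
  ⇒≡top⇒≤ {x} {y} e = begin
    x            ≡⟨ top-great x ⟩
    x ⊓ top      ≡⟨ cong (x ⊓_) (≡.sym e) ⟩
    x ⊓ (x →ₐ y) ≡⟨ C3 x y ⟩
    x ⊓ y        ∎
    where open ≡-Reasoning

  ⇒-identityˡ : top →ₐ x ≡ x
  ⇒-identityˡ {x} = begin
    top →ₐ x         ≡⟨ ≡.sym ⊓-identityˡ ⟩
    top ⊓ (top →ₐ x) ≡⟨ C3 top x ⟩
    top ⊓ x          ≡⟨ ⊓-identityˡ ⟩
    x                ∎
    where open ≡-Reasoning

  x≤x⇒top : x ≤ x →ₐ top
  x≤x⇒top {x} = ≡.trans (top-great x) (≡.sym (C3 x top))

  C1-≤ : x →ₐ y ≤ (y →ₐ z) →ₐ (x →ₐ z)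
  C1-≤ {x} {y} {z} = ⇒≡top⇒≤ (C1 x y z)

  C2-≤ : x →ₐ y ≤ ¬ₐ (x →ₐ ¬ₐ y)
  C2-≤ {x} {y} = ⇒≡top⇒≤ (C2 x y)

  ⇒-trans : (x →ₐ y) ⊓ (y →ₐ z) ≤ x →ₐ z
  ⇒-trans = ⇒-elim (x∧y≤y _ _) (≤-trans (x∧y≤x _ _) C1-≤)

  ⇒-conjoin : y ≤ x →ₐ (x ⊓ y)
  ⇒-conjoin {y} {x} = begin
    y                  ≡⟨ ≡.sym ⇒-identityˡ ⟩
    top →ₐ y           ≤⟨ C4 top y x ⟩
    x ⊓ top →ₐ x ⊓ y   ≡⟨ cong (_→ₐ x ⊓ y) ⊓-identityʳ ⟩
    x →ₐ x ⊓ y         ∎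
    where open ≤-Reasoning poset

  ⇒-refl : x →ₐ x ≡ top
  ⇒-refl {x} = ≤-antisym (top-great _) (≤-trans ⇒-conjoin (≤-reflexive (cong (x →ₐ_) ⊓-identityʳ)))

  ⇒-monoʳ-below : y ≤ z → z ≤ x → x →ₐ y ≤ x →ₐ z
  ⇒-monoʳ-below {y} {z} {x} y≤z z≤x = begin
    x →ₐ y             ≤⟨ C5 x y z ⟩
    z ⊔ₐ x →ₐ z ⊔ₐ y   ≡⟨ cong₂ _→ₐ_ (x≤y⇒x∨y≈y z≤x) (≡.trans (∨-comm z y) (x≤y⇒x∨y≈y y≤z)) ⟩
    x →ₐ z             ∎
    where open ≤-Reasoning poset

  ⇒⊓-intro : z ⊓ x ≤ y → z ≤ x →ₐ (x ⊓ y)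
  ⇒⊓-intro {z} {x} {y} zx≤y = ≤-trans ⇒-conjoin (⇒-monoʳ-below xz≤xy (x∧y≤x x y))
    where
    xz≤xy : x ⊓ z ≤ x ⊓ y
    xz≤xy = ∧-greatest (x∧y≤x x z) (≤-trans (≤-reflexive (∧-comm x z)) zx≤y)

  ¬-intro : z ⊓ x ≤ bot → z ≤ ¬ₐ x
  ¬-intro {x = x} zx≤bot = ≤-trans (⇒⊓-intro zx≤bot) (≤-reflexive (cong (x →ₐ_) ⊓-zeroʳ))

  ¬-antitone : x ≤ y → ¬ₐ y ≤ ¬ₐ x
  ¬-antitone x≤y = ¬-intro (⇒-elim (≤-trans (x∧y≤y _ _) x≤y) (x∧y≤x _ _))

  ¬x⊓x≡bot : ¬ₐ x ⊓ x ≡ bot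
  ¬x⊓x≡bot = ≤-antisym (⇒-elim (x∧y≤y _ _) (x∧y≤x _ _)) (bot-least _)

  x⇒¬x≡bot : x →ₐ ¬ₐ x ≡ bot
  x⇒¬x≡bot {x} = ≤-antisym (⇒≡top⇒≤ ¬[x⇒¬x]≡top) (bot-least _)
    where
    ¬[x⇒¬x]≡top : ¬ₐ (x →ₐ ¬ₐ x) ≡ top
    ¬[x⇒¬x]≡top = ≡.trans (≡.sym ⇒-identityˡ) (≡.trans (cong (_→ₐ ¬ₐ (x →ₐ ¬ₐ x)) (≡.sym ⇒-refl)) (C2 x x))

  x≤bot⇒¬x : x ≤ bot →ₐ ¬ₐ x
  x≤bot⇒¬x {x} = begin
    x                                ≡⟨ ≡.sym ⇒-identityˡ ⟩
    top →ₐ x                         ≤⟨ C1-≤ ⟩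
    (x →ₐ ¬ₐ x) →ₐ (top →ₐ ¬ₐ x)     ≡⟨ cong₂ _→ₐ_ x⇒¬x≡bot ⇒-identityˡ ⟩
    bot →ₐ ¬ₐ x                      ∎
    where open ≤-Reasoning poset

  bot⇒x≤¬x : bot →ₐ x ≤ ¬ₐ x
  bot⇒x≤¬x = ¬-intro (⇒-elim (≤-trans (x∧y≤y _ _) x≤bot⇒¬x) (≤-trans (x∧y≤x _ _) C2-≤))

  ⇒-excludes-¬antecedent : (x →ₐ y) ⊓ (¬ₐ x ⊓ y) ≤ bot
  ⇒-excludes-¬antecedent {x} {y} = ⇒-elim (x∧y≤y _ _) (≤-trans (x∧y≤x _ _) x⇒y≤¬[¬x⊓y])
    where
    open ≤-Reasoning poset
    x⇒y≤¬[¬x⊓y] : x →ₐ y ≤ ¬ₐ (¬ₐ x ⊓ y)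
    x⇒y≤¬[¬x⊓y] = begin
      x →ₐ y                 ≤⟨ C4 x y (¬ₐ x) ⟩
      ¬ₐ x ⊓ x →ₐ ¬ₐ x ⊓ y   ≡⟨ cong (_→ₐ ¬ₐ x ⊓ y) ¬x⊓x≡bot ⟩
      bot →ₐ ¬ₐ x ⊓ y        ≤⟨ bot⇒x≤¬x ⟩
      ¬ₐ (¬ₐ x ⊓ y)          ∎

  ¬¬x≤x⇒top : ¬ₐ ¬ₐ x ≤ x →ₐ top
  ¬¬x≤x⇒top {x} =
    ≤-trans (∧-greatest (≤-trans (top-great _) (≤-reflexive (≡.sym x⇒¬¬x≡top))) x≤x⇒top) ⇒-trans
    where
    x⇒¬¬x≡top : x →ₐ ¬ₐ ¬ₐ x ≡ top
    x⇒¬¬x≡top = ≡.trans (≡.sym (cong₂ _→ₐ_ ⇒-identityˡ (cong ¬ₐ_ ⇒-identityˡ))) (C2 top x)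

  -- With u = x ⊓ y and w = u ⊔ ¬y, the hypothesis forces z ≤ ¬¬w ≤ w ⇒ top, and
  -- C4 then meets both sides with y, which cuts w down to u.
  ⊓⇒-intro : z ⊓ (¬ₐ x ⊓ y) ≤ bot → z ≤ x ⊓ y →ₐ y
  ⊓⇒-intro {z} {x} {y} z¬xy≤bot = begin
    z                    ≤⟨ ¬-intro z⊓¬w≤bot ⟩
    ¬ₐ ¬ₐ w              ≤⟨ ¬¬x≤x⇒top ⟩
    w →ₐ top             ≤⟨ C4 w top y ⟩
    y ⊓ w →ₐ y ⊓ top     ≡⟨ cong₂ _→ₐ_ y⊓w≡u ⊓-identityʳ ⟩
    u →ₐ y               ∎
    where
    open ≤-Reasoning poset
    u w : Carrier
    u = x ⊓ y
    w = u ⊔ₐ ¬ₐ y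
    y⊓w≡u : y ⊓ w ≡ u
    y⊓w≡u = ≤-antisym
      (begin
        y ⊓ (u ⊔ₐ ¬ₐ y)           ≡⟨ ∧-distribˡ-∨ y u (¬ₐ y) ⟩
        y ⊓ u ⊔ₐ y ⊓ ¬ₐ y         ≤⟨ ∨-least (x∧y≤y _ _) (≤-trans (⇒-elim (x∧y≤x _ _) (x∧y≤y _ _)) (bot-least _)) ⟩
        u                        ∎)
      (∧-greatest (x∧y≤y x y) (x≤x∨y _ _))
    e : Carrier
    e = z ⊓ ¬ₐ w
    ey≤¬x : e ⊓ y ≤ ¬ₐ x
    ey≤¬x = ¬-intro (⇒-elim (∧-greatest (x∧y≤y _ _) (≤-trans (x∧y≤x _ _) (x∧y≤y _ _)))
      (≤-trans (x∧y≤x _ _) (≤-trans (x∧y≤x _ _) (≤-trans (x∧y≤y _ _) (¬-antitone (x≤x∨y _ _))))))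
    e≤¬y : e ≤ ¬ₐ y
    e≤¬y = ¬-intro (≤-trans (∧-greatest (≤-trans (x∧y≤x _ _) (x∧y≤x _ _)) (∧-greatest ey≤¬x (x∧y≤y _ _)))
                            z¬xy≤bot)
    z⊓¬w≤bot : z ⊓ ¬ₐ w ≤ bot
    z⊓¬w≤bot = ⇒-elim e≤¬y (≤-trans (x∧y≤y _ _) (¬-antitone (y≤x∨y _ _)))

  ⇒-intro : z ⊓ x ≤ y → z ⊓ (¬ₐ x ⊓ y) ≤ bot → z ≤ x →ₐ y
  ⇒-intro zx≤y z¬xy≤bot = ≤-trans (∧-greatest (⇒⊓-intro zx≤y) (⊓⇒-intro z¬xy≤bot)) ⇒-trans

module Soundness {c : Level} (A : CHA c) (v : ℕ → CHA.Carrier A) where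

  open CHA A
  open CHAProperties A
  open IsDistributiveLattice isDistributiveLattice using (∧-distribˡ-∨)

  ⟪_⟫ : Formula → Carrier
  ⟪ φ ⟫ = ⟦ φ ⟧ v

  Below : Carrier → Ctx → Set c
  Below x Γ = All (λ φ → x ≤ ⟪ φ ⟫) Γ

  Below-≤ : ∀ {x y Γ} → y ≤ x → Below x Γ → Below y Γ
  Below-≤ y≤x = All.map (≤-trans y≤x)

  ≤-foldl⁻ : ∀ {x} acc Γ → x ≤ ⟪ foldl _∧_ acc Γ ⟫ → x ≤ ⟪ acc ⟫ × Below x Γ
  ≤-foldl⁻ acc []      x≤ = x≤ , []
  ≤-foldl⁻ acc (φ ∷ Γ) x≤ =
    let x≤acc∧φ , B = ≤-foldl⁻ (acc ∧ φ) Γ x≤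
    in ≤-trans x≤acc∧φ (x∧y≤x _ _) , ≤-trans x≤acc∧φ (x∧y≤y _ _) ∷ B

  ≤-foldl⁺ : ∀ {x} acc Γ → x ≤ ⟪ acc ⟫ → Below x Γ → x ≤ ⟪ foldl _∧_ acc Γ ⟫
  ≤-foldl⁺ acc []      x≤acc []      = x≤acc
  ≤-foldl⁺ acc (φ ∷ Γ) x≤acc (x≤φ ∷ B) = ≤-foldl⁺ (acc ∧ φ) Γ (∧-greatest x≤acc x≤φ) B

  conj-Below : ∀ Γ → Below ⟪ conj Γ ⟫ Γ
  conj-Below []      = []
  conj-Below (α ∷ Γ) = let α≤ , B = ≤-foldl⁻ α Γ ≤-refl in α≤ ∷ B

  ≤-conj : ∀ {x} Γ → Below x Γ → x ≤ ⟪ conj Γ ⟫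
  ≤-conj []      _         = top-great _
  ≤-conj (α ∷ Γ) (x≤α ∷ B) = ≤-foldl⁺ α Γ x≤α B

  module _ {S : SeqSet} (valid : ∀ e → τS S e → Sat v e) where

    sound : ∀ {Γ Π x} → S ⊢CHC Γ ▸ Π → Below x Γ → x ≤ ⟪ disj Π ⟫
    sound {Γ} {Π} (ax s∈S) B = ≤-trans (≤-conj Γ B) (valid _ ((Γ ▸ Π) , s∈S , ≡.refl))
    sound (set-eq Γ≈Γ' d) B = sound d (anti-mono (proj₁ (Γ≈Γ' _)) B)
    sound id            B = head B
    sound ax0           B = head B
    sound ax1           B = top-great _
    sound (w-l d)       B = sound d (tail B)
    sound (w-r d)       B = ≤-trans (sound d B) (bot-least _)
    sound (cut {Γ = Γ} d e) B = sound e (sound d (++⁻ˡ Γ B) ∷ ++⁻ʳ Γ B)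
    sound (∧-l₁ d)      B = sound d (≤-trans (head B) (x∧y≤x _ _) ∷ tail B)
    sound (∧-l₂ d)      B = sound d (≤-trans (head B) (x∧y≤y _ _) ∷ tail B)
    sound (∧-r d e)     B = ∧-greatest (sound d B) (sound e B)
    sound (∨-r₁ d)      B = ≤-trans (sound d B) (x≤x∨y _ _)
    sound (∨-r₂ d)      B = ≤-trans (sound d B) (y≤x∨y _ _)
    sound {Π = Π} {x} (∨-l {α} {β} {Γ} d e) B = begin
      x                          ≤⟨ ∧-greatest ≤-refl (head B) ⟩
      x ⊓ (⟪ α ⟫ ⊔ₐ ⟪ β ⟫)         ≡⟨ ∧-distribˡ-∨ x ⟪ α ⟫ ⟪ β ⟫ ⟩
      x ⊓ ⟪ α ⟫ ⊔ₐ x ⊓ ⟪ β ⟫       ≤⟨ ∨-least (sound d (x∧y≤y _ _ ∷ Γ-below)) (sound e (x∧y≤y _ _ ∷ Γ-below)) ⟩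
      ⟪ disj Π ⟫                 ∎
      where
      open ≤-Reasoning poset
      Γ-below : ∀ {y} → Below (x ⊓ y) Γ
      Γ-below = Below-≤ (x∧y≤x _ _) (tail B)
    sound {x = x} (⇒-la {α} {β} {Γ} {Δ} d e) B = sound e (++⁺ (++⁻ˡ Δ B) (⇒-elim x≤α x≤α⇒β ∷ []))
      where
      x≤α : x ≤ ⟪ α ⟫
      x≤α = sound d (++⁻ˡ Γ (++⁻ʳ Δ B))
      x≤α⇒β : x ≤ ⟪ α ⇒ β ⟫
      x≤α⇒β = head (++⁻ʳ Γ (++⁻ʳ Δ B))
    sound {x = x} (⇒-lb {α} {β} {Γ} {Δ} d e) B =
      ≤-trans (∧-greatest x≤α⇒β (∧-greatest x≤¬α x≤β)) ⇒-excludes-¬antecedent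
      where
      x≤α⇒β : x ≤ ⟪ α ⇒ β ⟫
      x≤α⇒β = head (++⁻ʳ Δ (++⁻ʳ Γ B))
      xα≤β : x ⊓ ⟪ α ⟫ ≤ ⟪ β ⟫
      xα≤β = ⇒-elim (x∧y≤y _ _) (≤-trans (x∧y≤x _ _) x≤α⇒β)
      x≤¬α : x ≤ ¬ₐ ⟪ α ⟫
      x≤¬α = ¬-intro (sound e (++⁺ (Below-≤ (x∧y≤x _ _) (++⁻ˡ Δ (++⁻ʳ Γ B))) (x∧y≤y _ _ ∷ xα≤β ∷ [])))
      x≤β : x ≤ ⟪ β ⟫
      x≤β = sound d (x≤¬α ∷ ++⁻ˡ Γ B)
    sound (⇒-r {Γ = Γ} {Δ} d e) B = ⇒-intro
      (sound d (x∧y≤y _ _ ∷ Below-≤ (x∧y≤x _ _) (++⁻ˡ Γ B)))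
      (sound e (++⁺ (Below-≤ (x∧y≤x _ _) (++⁻ʳ Γ B))
                    (≤-trans (x∧y≤y _ _) (x∧y≤x _ _) ∷ ≤-trans (x∧y≤y _ _) (x∧y≤y _ _) ∷ [])))

lemma4p9 : ∀ {c : Level} (S : SeqSet) (s : Sequent) → S ⊢CHC s → τS S ⊨CHA[ c ] τ s
lemma4p9 S (Γ ▸ Π) d A v valid = sound valid d (conj-Below Γ)
  where open Soundness A v
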